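{- Let $P$ be a partial field. The support $\mathrm{Supp}(p)=\{J\subseteq[n] : p_J\ne 0\}$ of every strong orthogonal matroid $p$ over $P$ is the set of bases of an orthogonal matroid on $[n]$.
   Context: A partial field $P=(G,R)$ consists of a commutative ring $R$ with $1$ and a subgroup $G$ of its unit group containing $-1$; elements of $P$ are those of $G\cup\{0\}$. Let $N=2^n-1$; $\mathbf{P}^N(P)$ is the set of nonzero vectors $(p_J)_{J\subseteq[n]}$ with entries in $G\cup\{0\}$ modulo scaling by $G$. $\Delta$ denotes symmetric difference. The Wick equations are $\sum_{j=1}^{k}(-1)^j X_{J_1\Delta\{i_j\}}X_{J_2\Delta\{i_j\}}=0$ for all $J_1,J_2\subseteq[n]$ with $J_1\Delta J_2=\{i_1<\dots<i_k\}$ (interpreted in $R$). A strong orthogonal matroid over $P$ is a point $p\in\mathbf{P}^N(P)$ satisfying all Wick equations. An orthogonal matroid on $E$ is a nonempty collection $\mathcal{B}$ of subsets of $E$ such that for all $B_1,B_2\in\mathcal{B}$ and $x_1\in B_1\Delta B_2$ there is $x_2\in B_1\Delta B_2$, $x_2\ne x_1$, with $B_1\Delta\{x_1,x_2\}\in\mathcal{B}$. -}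

module Defs where

open import Level using (Level; _⊔_; suc)
open import Data.Nat using (ℕ)
open import Data.Bool using (Bool; true; false; _xor_; not)
open import Data.Fin using (Fin)
open import Data.Fin.Subset using (Subset; _∈_; ⁅_⁆)
open import Data.Vec using (Vec; zipWith; lookup)
open import Data.List using (List; []; _∷_; allFin)
open import Data.Product using (Σ; ∃; _×_; _,_)
open import Data.Sum using (_⊎_)
open import Relation.Nullary using (¬_)
open import Relation.Unary using (Pred)
open import Relation.Binary.PropositionalEquality using (_≡_)
open import Algebra.Bundles using (CommutativeRing)

record PartialField (c ℓ g : Level) : Set (Level.suc (c ⊔ ℓ ⊔ g)) where
  field
    R : CommutativeRing c ℓ
  open CommutativeRing R public
  field
    G         : Pred Carrier g
    G-resp    : ∀ {x y} → x ≈ y → G x → G y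
    G-one     : G 1#
    G-minus1  : G (- 1#)
    G-mul     : ∀ {x y} → G x → G y → G (x * y)
    G-inv     : ∀ {x} → G x → Σ Carrier (λ y → G y × (x * y ≈ 1#))

_Δ_ : ∀ {n} → Subset n → Subset n → Subset n
_Δ_ = zipWith _xor_

infixl 6 _Δ_

module _ {c ℓ g} (P : PartialField c ℓ g) where
  open PartialField P

  -- A vector (p_J)_{J ⊆ [n]} with entries in G ∪ {0}
  -- (a representative of a point of P^N(P), N = 2^n - 1).
  EntriesInP : ∀ {n} → (Subset n → Carrier) → Set (ℓ ⊔ g)
  EntriesInP p = ∀ J → G (p J) ⊎ (p J ≈ 0#)

  NonZeroVec : ∀ {n} → (Subset n → Carrier) → Set ℓ
  NonZeroVec p = ¬ (∀ J → p J ≈ 0#)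

  -- Wick sum  Σ_{j=1}^{k} (-1)^j X_{J1 Δ {i_j}} X_{J2 Δ {i_j}},
  -- where J1 Δ J2 = {i_1 < … < i_k}.  We run over all i ∈ Fin n in
  -- increasing order; 'neg' records whether the next index of
  -- J1 Δ J2 gets the sign -1 (it starts as true, since j = 1).
  wickGo : ∀ {n} → (Subset n → Carrier) → Subset n → Subset n →
           Bool → List (Fin n) → Carrier
  wickGo p J₁ J₂ neg [] = 0#
  wickGo p J₁ J₂ neg (i ∷ is) with lookup (J₁ Δ J₂) i
  ... | false = wickGo p J₁ J₂ neg is
  ... | true  = sgn neg (p (J₁ Δ ⁅ i ⁆) * p (J₂ Δ ⁅ i ⁆))
                + wickGo p J₁ J₂ (not neg) is
    where
    sgn : Bool → Carrier → Carrier
    sgn true  x = - x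
    sgn false x = x

  wickSum : ∀ {n} → (Subset n → Carrier) → Subset n → Subset n → Carrier
  wickSum {n} p J₁ J₂ = wickGo p J₁ J₂ true (allFin n)

  WickEquations : ∀ {n} → (Subset n → Carrier) → Set ℓ
  WickEquations p = ∀ J₁ J₂ → wickSum p J₁ J₂ ≈ 0#

  record StrongOrthogonalMatroid {n : ℕ} (p : Subset n → Carrier) : Set (ℓ ⊔ g) where
    field
      entries : EntriesInP p
      nonzero : NonZeroVec p
      wick    : WickEquations p

  Supp : ∀ {n} → (Subset n → Carrier) → Pred (Subset n) ℓ
  Supp p J = ¬ (p J ≈ 0#)

record IsOrthogonalMatroid {a} {n : ℕ} (ℬ : Pred (Subset n) a) : Set a where
  field
    nonempty : ∃ λ B → ℬ B
    exchange : ∀ B₁ B₂ → ℬ B₁ → ℬ B₂ → ∀ x₁ → x₁ ∈ B₁ Δ B₂ →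
               ∃ λ x₂ → x₂ ∈ B₁ Δ B₂ × ¬ (x₂ ≡ x₁) × ℬ (B₁ Δ ⁅ x₁ ⁆ Δ ⁅ x₂ ⁆)

-- Given bases B₁, B₂ and x₁ ∈ B₁ Δ B₂, apply the Wick equation to J₁ = B₁ Δ {x₁}
-- and J₂ = B₂ Δ {x₁}. Then J₁ Δ J₂ = B₁ Δ B₂, and the term of index x₁ is
-- ± p(B₁) p(B₂), a product of units, hence nonzero. A sum that vanishes cannot
-- have exactly one nonzero term, so some other i ∈ B₁ Δ B₂ has
-- p(J₁ Δ {i}) ≠ 0, i.e. B₁ Δ {x₁, i} lies in the support.
module Submission where

open import Defs
open import Data.Nat using (ℕ)
open import Data.Bool using (Bool; true; false; _xor_; not)
open import Data.Bool.Properties using (xor-assoc; xor-comm; xor-same; xor-identityʳ)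
open import Data.Fin using (Fin)
open import Data.Fin.Properties using (any?) renaming (_≟_ to _≟ᶠ_)
open import Data.Fin.Subset using (Subset; _∈_; _∉_; ⁅_⁆)
open import Data.Fin.Subset.Properties using (_∈?_; anySubset?)
open import Data.Vec using ([]; _∷_; lookup)
open import Data.Vec.Properties using ([]=⇒lookup; lookup⇒[]=)
open import Data.List using ([]; _∷_; allFin)
open import Data.List.Relation.Unary.Any using (here; there)
open import Data.List.Relation.Unary.All as All using (All; []; _∷_)
open import Data.List.Relation.Unary.AllPairs using (_∷_)
open import Data.List.Relation.Unary.Unique.Propositional using (Unique)
open import Data.List.Relation.Unary.Unique.Propositional.Properties using (allFin⁺)
open import Data.List.Membership.Propositional using () renaming (_∈_ to _∈ₗ_)
open import Data.List.Membership.Propositional.Properties using (∈-allFin)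
open import Data.Product using (∃; _×_; _,_)
open import Data.Sum using (inj₁; inj₂)
open import Relation.Nullary using (¬_; yes; no; ¬?; _×-dec_; contradiction)
open import Relation.Unary using (Decidable)
open import Relation.Binary.PropositionalEquality
  using (_≡_; _≢_; refl; cong; cong₂; subst) renaming (sym to ≡-sym; trans to ≡-trans)
import Algebra.Properties.Ring as RingProperties
import Relation.Binary.Reasoning.Setoid as SetoidReasoning

xor-cancelʳ : ∀ a c → (a xor c) xor c ≡ a
xor-cancelʳ a c = ≡-trans (xor-assoc a c c) (≡-trans (cong (a xor_) (xor-same c)) (xor-identityʳ a))

xor-cancel-common : ∀ a b c → (a xor c) xor (b xor c) ≡ a xor b
xor-cancel-common a b c = begin
  (a xor c) xor (b xor c) ≡⟨ cong (_xor (b xor c)) (xor-comm a c) ⟩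
  (c xor a) xor (b xor c) ≡⟨ xor-assoc c a (b xor c) ⟩
  c xor (a xor (b xor c)) ≡⟨ cong (c xor_) (≡-sym (xor-assoc a b c)) ⟩
  c xor ((a xor b) xor c) ≡⟨ xor-comm c _ ⟩
  ((a xor b) xor c) xor c ≡⟨ xor-cancelʳ (a xor b) c ⟩
  a xor b                 ∎
  where open Relation.Binary.PropositionalEquality.≡-Reasoning

Δ-cancelʳ : ∀ {n} (v c : Subset n) → v Δ c Δ c ≡ v
Δ-cancelʳ []       []       = refl
Δ-cancelʳ (a ∷ v) (x ∷ c) = cong₂ _∷_ (xor-cancelʳ a x) (Δ-cancelʳ v c)

Δ-cancel-common : ∀ {n} (v w c : Subset n) → (v Δ c) Δ (w Δ c) ≡ v Δ w
Δ-cancel-common []       []       []       = refl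
Δ-cancel-common (a ∷ v) (b ∷ w) (x ∷ c) = cong₂ _∷_ (xor-cancel-common a b x) (Δ-cancel-common v w c)

module _ {c ℓ g} (P : PartialField c ℓ g) where
  open PartialField P renaming (refl to ≈-refl)
  open RingProperties ring using (-0#≈0#; -‿injective)
  open SetoidReasoning setoid

  trivial⇒≈0 : 1# ≈ 0# → ∀ x → x ≈ 0#
  trivial⇒≈0 1≈0 x = begin
    x      ≈⟨ *-identityʳ x ⟨
    x * 1# ≈⟨ *-congˡ 1≈0 ⟩
    x * 0# ≈⟨ zeroʳ x ⟩
    0#     ∎

  G⇒≉0 : ¬ 1# ≈ 0# → ∀ {x} → G x → ¬ x ≈ 0#
  G⇒≉0 1≉0 Gx x≈0 with G-inv Gx
  ... | y , _ , xy≈1 = 1≉0 (begin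
    1#     ≈⟨ xy≈1 ⟨
    _ * y  ≈⟨ *-congʳ x≈0 ⟩
    0# * y ≈⟨ zeroˡ y ⟩
    0#     ∎)

  ≈0? : ∀ {n} {p : Subset n → Carrier} → ¬ 1# ≈ 0# → EntriesInP P p →
        Decidable (λ J → p J ≈ 0#)
  ≈0? 1≉0 entries J with entries J
  ... | inj₁ GpJ = no (G⇒≉0 1≉0 GpJ)
  ... | inj₂ pJ≈0 = yes pJ≈0

  signed : Bool → Carrier → Carrier
  signed true  x = - x
  signed false x = x

  signed-≈0 : ∀ s {x} → x ≈ 0# → signed s x ≈ 0#
  signed-≈0 true  x≈0 = trans (-‿cong x≈0) -0#≈0#
  signed-≈0 false x≈0 = x≈0

  signed-≈0⁻¹ : ∀ s {x} → signed s x ≈ 0# → x ≈ 0#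
  signed-≈0⁻¹ true  -x≈0 = -‿injective (trans -x≈0 (sym -0#≈0#))
  signed-≈0⁻¹ false x≈0  = x≈0

  module WickSum {n} (p : Subset n → Carrier) (J₁ J₂ : Subset n) where

    term : Fin n → Carrier
    term i = p (J₁ Δ ⁅ i ⁆) * p (J₂ Δ ⁅ i ⁆)

    FirstFactorVanishes : Fin n → Set ℓ
    FirstFactorVanishes i = i ∈ J₁ Δ J₂ → p (J₁ Δ ⁅ i ⁆) ≈ 0#

    wickGo-∷-∈ : ∀ {i} neg is → i ∈ J₁ Δ J₂ →
                 wickGo P p J₁ J₂ neg (i ∷ is) ≡ signed neg (term i) + wickGo P p J₁ J₂ (not neg) is
    wickGo-∷-∈ {i} neg is i∈ with lookup (J₁ Δ J₂) i | []=⇒lookup i∈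
    wickGo-∷-∈ true  is i∈ | true | refl = refl
    wickGo-∷-∈ false is i∈ | true | refl = refl

    wickGo-∷-∉ : ∀ {i} neg is → i ∉ J₁ Δ J₂ →
                 wickGo P p J₁ J₂ neg (i ∷ is) ≡ wickGo P p J₁ J₂ neg is
    wickGo-∷-∉ {i} neg is i∉ with lookup (J₁ Δ J₂) i in eq
    ... | false = refl
    ... | true  = contradiction (lookup⇒[]= i (J₁ Δ J₂) eq) i∉

    drop-vanishing-term : ∀ {i} neg {y} → p (J₁ Δ ⁅ i ⁆) ≈ 0# → signed neg (term i) + y ≈ y
    drop-vanishing-term neg {y} v = begin
      signed neg (term _) + y ≈⟨ +-congʳ (signed-≈0 neg (trans (*-congʳ v) (zeroˡ _))) ⟩
      0# + y                  ≈⟨ +-identityˡ y ⟩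
      y                       ∎

    wickGo-≈0 : ∀ neg is → All FirstFactorVanishes is → wickGo P p J₁ J₂ neg is ≈ 0#
    wickGo-≈0 neg []       []       = ≈-refl
    wickGo-≈0 neg (i ∷ is) (v ∷ vs) with i ∈? J₁ Δ J₂
    ... | yes i∈ = begin
      wickGo P p J₁ J₂ neg (i ∷ is)                     ≡⟨ wickGo-∷-∈ neg is i∈ ⟩
      signed neg (term i) + wickGo P p J₁ J₂ (not neg) is ≈⟨ drop-vanishing-term neg (v i∈) ⟩
      wickGo P p J₁ J₂ (not neg) is                     ≈⟨ wickGo-≈0 (not neg) is vs ⟩
      0#                                                ∎
    ... | no i∉ = trans (reflexive (wickGo-∷-∉ neg is i∉)) (wickGo-≈0 neg is vs)

    module _ {x : Fin n} (x∈ : x ∈ J₁ Δ J₂) (others : ∀ i → i ≢ x → FirstFactorVanishes i) where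

      wickGo≈0⇒term≈0 : ∀ neg is → x ∈ₗ is → Unique is →
                        wickGo P p J₁ J₂ neg is ≈ 0# → term x ≈ 0#
      wickGo≈0⇒term≈0 neg (x ∷ is) (here refl) (x≢ ∷ _) sum≈0 =
        signed-≈0⁻¹ neg (begin
          signed neg (term x)                               ≈⟨ +-identityʳ _ ⟨
          signed neg (term x) + 0#                          ≈⟨ +-congˡ (wickGo-≈0 (not neg) is rest-vanishes) ⟨
          signed neg (term x) + wickGo P p J₁ J₂ (not neg) is ≡⟨ wickGo-∷-∈ neg is x∈ ⟨
          wickGo P p J₁ J₂ neg (x ∷ is)                     ≈⟨ sum≈0 ⟩
          0#                                                ∎)
        where
        rest-vanishes : All FirstFactorVanishes is
        rest-vanishes = All.map (λ x≢i → others _ (λ i≡x → x≢i (≡-sym i≡x))) x≢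
      wickGo≈0⇒term≈0 neg (i ∷ is) (there x∈is) (i≢ ∷ unique) sum≈0 with i ∈? J₁ Δ J₂
      ... | yes i∈ = wickGo≈0⇒term≈0 (not neg) is x∈is unique (begin
        wickGo P p J₁ J₂ (not neg) is                     ≈⟨ drop-vanishing-term neg (others i (All.lookup i≢ x∈is) i∈) ⟨
        signed neg (term i) + wickGo P p J₁ J₂ (not neg) is ≡⟨ wickGo-∷-∈ neg is i∈ ⟨
        wickGo P p J₁ J₂ neg (i ∷ is)                     ≈⟨ sum≈0 ⟩
        0#                                                ∎)
      ... | no i∉ = wickGo≈0⇒term≈0 neg is x∈is unique (trans (reflexive (≡-sym (wickGo-∷-∉ neg is i∉))) sum≈0)

      wickSum≈0⇒term≈0 : wickSum P p J₁ J₂ ≈ 0# → term x ≈ 0#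
      wickSum≈0⇒term≈0 = wickGo≈0⇒term≈0 true (allFin n) (∈-allFin x) (allFin⁺ n)

  module _ {n} {p : Subset n → Carrier} (SOM : StrongOrthogonalMatroid P p) where
    open StrongOrthogonalMatroid SOM

    nontrivial : ¬ 1# ≈ 0#
    nontrivial 1≈0 = nonzero (λ J → trivial⇒≈0 1≈0 (p J))

    Supp? : Decidable (Supp P p)
    Supp? J = ¬? (≈0? nontrivial entries J)

    Supp⇒G : ∀ {B} → Supp P p B → G (p B)
    Supp⇒G {B} B∈ with entries B
    ... | inj₁ GpB  = GpB
    ... | inj₂ pB≈0 = contradiction pB≈0 B∈

    Supp-nonempty : ∃ (Supp P p)
    Supp-nonempty with anySubset? Supp?
    ... | yes J∈Supp = J∈Supp
    ... | no  ∄J     = contradiction all-zero nonzero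
      where
      all-zero : ∀ J → p J ≈ 0#
      all-zero J with ≈0? nontrivial entries J
      ... | yes pJ≈0 = pJ≈0
      ... | no  pJ≉0 = contradiction (J , pJ≉0) ∄J

    module _ (J₁ J₂ : Subset n) where
      open WickSum p J₁ J₂

      Witness : Fin n → Fin n → Set ℓ
      Witness x i = i ∈ J₁ Δ J₂ × i ≢ x × Supp P p (J₁ Δ ⁅ i ⁆)

      Witness? : ∀ x → Decidable (Witness x)
      Witness? x i = i ∈? J₁ Δ J₂ ×-dec ¬? (i ≟ᶠ x) ×-dec Supp? (J₁ Δ ⁅ i ⁆)

      wick-witness : ∀ {x} → x ∈ J₁ Δ J₂ → ¬ term x ≈ 0# → ∃ (Witness x)
      wick-witness {x} x∈ term≉0 with any? (Witness? x)
      ... | yes witness = witness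
      ... | no  ∄i      = contradiction (wickSum≈0⇒term≈0 x∈ others (wick J₁ J₂)) term≉0
        where
        others : ∀ i → i ≢ x → FirstFactorVanishes i
        others i i≢x i∈ with ≈0? nontrivial entries (J₁ Δ ⁅ i ⁆)
        ... | yes v   = v
        ... | no  nv  = contradiction (i , i∈ , i≢x , nv) ∄i

    Supp-exchange : ∀ B₁ B₂ → Supp P p B₁ → Supp P p B₂ → ∀ x₁ → x₁ ∈ B₁ Δ B₂ →
                    ∃ λ x₂ → x₂ ∈ B₁ Δ B₂ × ¬ (x₂ ≡ x₁) × Supp P p (B₁ Δ ⁅ x₁ ⁆ Δ ⁅ x₂ ⁆)
    Supp-exchange B₁ B₂ B₁∈ B₂∈ x₁ x₁∈
      with wick-witness (B₁ Δ ⁅ x₁ ⁆) (B₂ Δ ⁅ x₁ ⁆) (subst (x₁ ∈_) (≡-sym J₁ΔJ₂≡) x₁∈) term≉0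
      where
      J₁ΔJ₂≡ : (B₁ Δ ⁅ x₁ ⁆) Δ (B₂ Δ ⁅ x₁ ⁆) ≡ B₁ Δ B₂
      J₁ΔJ₂≡ = Δ-cancel-common B₁ B₂ ⁅ x₁ ⁆
      term≉0 : ¬ p (B₁ Δ ⁅ x₁ ⁆ Δ ⁅ x₁ ⁆) * p (B₂ Δ ⁅ x₁ ⁆ Δ ⁅ x₁ ⁆) ≈ 0#
      term≉0 rewrite Δ-cancelʳ B₁ ⁅ x₁ ⁆ | Δ-cancelʳ B₂ ⁅ x₁ ⁆ =
        G⇒≉0 nontrivial (G-mul (Supp⇒G B₁∈) (Supp⇒G B₂∈))
    ... | x₂ , x₂∈ , x₂≢x₁ , exchanged∈ =
      x₂ , subst (x₂ ∈_) (Δ-cancel-common B₁ B₂ ⁅ x₁ ⁆) x₂∈ , x₂≢x₁ , exchanged∈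

proposition3p8 : ∀ {c ℓ g} (P : PartialField c ℓ g) (n : ℕ)
                 (p : Subset n → PartialField.Carrier P) →
                 StrongOrthogonalMatroid P p →
                 IsOrthogonalMatroid (Supp P p)
proposition3p8 P n p SOM = record
  { nonempty = Supp-nonempty P SOM
  ; exchange = Supp-exchange P SOM
  }
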